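{- For every integer $n\ge 1$, the number $T(2,n)=\dfrac{6\,(2n)!}{n!\,(n+2)!}$ equals the number of ordered pairs $(P,Q)$ of Dyck paths of total semilength $n$ (the semilengths of $P$ and $Q$ sum to $n$) such that $|h(P)-h(Q)|\le 1$.
   Context: Paths use steps $(1,1)$ and $(1,-1)$. The level of a point is its $y$-coordinate. A Dyck path of semilength $n$ is such a path starting at $(0,0)$, ending at $(2n,0)$, and never going below level $0$; the empty path is the Dyck path of semilength $0$. The height $h(P)$ of a path $P$ is the highest level it reaches (the empty path has height $0$). -}

module Defs where

open import Data.Nat using (ℕ; zero; suc; _+_; _*_; _⊔_; _≤_; _∸_; _!)
open import Data.Nat.Properties using (_≤?_)
open import Data.Bool using (Bool; true; false; T; _∧_)
open import Data.List using (List; []; _∷_; concatMap; filter; length; upTo)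
open import Data.Product using (_×_; _,_)
open import Relation.Nullary.Decidable using (T?; Dec; _×-dec_)
open import Data.Nat.DivMod using (_/_)
open import Data.Nat.Properties using (_!*_!≢0)

-- Steps: U = (1,1), D = (1,-1).  A path is a list of steps starting at (0,0).
data Step : Set where
  U D : Step

allWords : ℕ → List (List Step)
allWords zero    = [] ∷ []
allWords (suc m) = concatMap (λ w → (U ∷ w) ∷ (D ∷ w) ∷ []) (allWords m)

validFrom : ℕ → List Step → Bool
validFrom zero    []      = true
validFrom (suc _) []      = false
validFrom ℓ       (U ∷ w) = validFrom (suc ℓ) w
validFrom zero    (D ∷ w) = false
validFrom (suc ℓ) (D ∷ w) = validFrom ℓ w

isDyck : List Step → Bool
isDyck w = validFrom 0 w

dyckPaths : ℕ → List (List Step)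
dyckPaths k = filter (λ w → T? (isDyck w)) (allWords (2 * k))

-- Highest level reached by a path started at level ℓ (levels below 0 cannot
-- occur for Dyck paths; truncated subtraction is harmless there).
heightFrom : ℕ → List Step → ℕ
heightFrom ℓ []      = ℓ
heightFrom ℓ (U ∷ w) = ℓ ⊔ heightFrom (suc ℓ) w
heightFrom ℓ (D ∷ w) = ℓ ⊔ heightFrom (ℓ ∸ 1) w

height : List Step → ℕ
height w = heightFrom 0 w

closeHeights : ℕ → ℕ → Set
closeHeights a b = (a ≤ suc b) × (b ≤ suc a)

closeHeights? : ∀ a b → Dec (closeHeights a b)
closeHeights? a b = (a ≤? suc b) ×-dec (b ≤? suc a)

dyckPairs : ℕ → List (List Step × List Step)
dyckPairs n = concatMap (λ k → concatMap (λ p → concatMap (λ q → (p , q) ∷ []) (dyckPaths (n ∸ k))) (dyckPaths k)) (upTo (suc n))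

countPairs : ℕ → ℕ
countPairs n = length (filter (λ pq → closeHeights? (height (Data.Product.proj₁ pq)) (height (Data.Product.proj₂ pq))) (dyckPairs n))
  where import Data.Product

-- T(2,n) = 6 (2n)! / (n! (n+2)!)   (Data.Nat floor division; the paper's value is an integer)
T2 : ℕ → ℕ
T2 n = (6 * (2 * n) !) / (n ! * (n + 2) !)
  where instance _ = n !* (n + 2) !≢0

-- Let D_y be the generating function, by length, of Dyck paths of height
-- below y, and E_y = D_{y+1} - D_y that of paths of height exactly y.  The
-- first-return decomposition gives D_{y+1} = 1 + x² D_y D_{y+1}, and two
-- consecutive instances of it yield E_y D_{y+2} = E_y + E_{y+1}.  Grouping Q by
-- its height, the pairs with h(P) ≤ h(Q) + 1 are counted by
-- Σ_y [x^{2n}] E_y D_{y+2} = Σ_y [x^{2n}] (E_y + E_{y+1}) = 2 C_n, and likewise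
-- those with h(Q) ≤ h(P) + 1.  Since one of the two inequalities always holds,
-- the wanted count plus the total number C_{n+1} of pairs is 4 C_n, and the
-- Catalan formula (via ballot numbers) turns 4 C_n - C_{n+1} into
-- 6 (2n)! / (n! (n+2)!).

module Submission where

open import Defs
open import Data.Nat using (ℕ; _≥_)
open import Relation.Binary.PropositionalEquality using (_≡_)

open import Data.Empty using (⊥-elim)
open import Data.List using (List; []; _∷_; _++_; concatMap; filter; length; applyUpTo; upTo)
open import Data.List.Relation.Unary.All as All using (All; []; _∷_)
open import Data.List.Relation.Unary.All.Properties using (concat⁺; map⁺; filter⁺)
open import Data.Nat
open import Data.Nat.DivMod using (m*n/n≡m)
open import Data.Nat.Induction using (<-rec)
open import Data.Nat.Properties
open import Algebra.Properties.CommutativeSemigroup +-commutativeSemigroup using (interchange)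
open import Data.Nat.Tactic.RingSolver using (solve-∀)
open import Data.Parity.Base using (0ℙ; _⁻¹)
open import Data.Parity.Properties using (suc-homo-⁻¹; ⁻¹-selfInverse; *-homo-*)
open import Data.Product using (_×_; _,_; proj₁; proj₂)
open import Data.Sum as Sum using (_⊎_; inj₁; inj₂)
open import Function using (_∘_; id)
open import Relation.Binary.PropositionalEquality
  using (_≢_; _≗_; refl; sym; trans; cong; cong₂; subst; subst₂; module ≡-Reasoning)
open import Relation.Nullary using (Dec; yes; no; ¬_)
open import Relation.Nullary.Decidable using (T?; _×-dec_)
open ≡-Reasoning

-- Finite sums

∑< : ℕ → (ℕ → ℕ) → ℕ
∑< zero    f = 0
∑< (suc n) f = ∑< n f + f n

infixr 6.5 ∑<
syntax ∑< n (λ i → e) = ∑[ i < n ] e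

∑<-cong : ∀ n {f g : ℕ → ℕ} → (∀ i → i < n → f i ≡ g i) → ∑[ i < n ] f i ≡ ∑[ i < n ] g i
∑<-cong zero    f≡g = refl
∑<-cong (suc n) f≡g = cong₂ _+_ (∑<-cong n (λ i i<n → f≡g i (m<n⇒m<1+n i<n))) (f≡g n ≤-refl)

∑<-zero : ∀ n → ∑[ i < n ] 0 ≡ 0
∑<-zero zero    = refl
∑<-zero (suc n) = trans (+-identityʳ _) (∑<-zero n)

∑<-+ : ∀ n (f g : ℕ → ℕ) → ∑[ i < n ] (f i + g i) ≡ ∑[ i < n ] f i + ∑[ i < n ] g i
∑<-+ zero    f g = refl
∑<-+ (suc n) f g = trans (cong (_+ (f n + g n)) (∑<-+ n f g)) (interchange (∑< n f) (∑< n g) (f n) (g n))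

∑<-swap : ∀ n m (F : ℕ → ℕ → ℕ) → ∑[ i < n ] ∑[ j < m ] F i j ≡ ∑[ j < m ] ∑[ i < n ] F i j
∑<-swap zero    m F = sym (∑<-zero m)
∑<-swap (suc n) m F = trans (cong (_+ ∑[ j < m ] F n j) (∑<-swap n m F))
  (sym (∑<-+ m (λ j → ∑[ i < n ] F i j) (F n)))

∑<-suc : ∀ n (f : ℕ → ℕ) → ∑[ i < suc n ] f i ≡ f 0 + ∑[ i < n ] f (suc i)
∑<-suc zero    f = +-comm 0 (f 0)
∑<-suc (suc n) f = trans (cong (_+ f (suc n)) (∑<-suc n f)) (+-assoc (f 0) _ _)

∑<-reverse : ∀ n (f : ℕ → ℕ) → ∑[ i < n ] f i ≡ ∑[ i < n ] f (n ∸ suc i)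
∑<-reverse zero    f = refl
∑<-reverse (suc n) f = begin
  ∑[ i < n ] f i + f n                  ≡⟨ cong (_+ f n) (∑<-reverse n f) ⟩
  ∑[ i < n ] f (n ∸ suc i) + f n        ≡⟨ +-comm _ (f n) ⟩
  f n + ∑[ i < n ] f (n ∸ suc i)        ≡⟨ sym (∑<-suc n (λ i → f (n ∸ i))) ⟩
  ∑[ i < suc n ] f (suc n ∸ suc i)      ∎

𝟙 : ∀ {p} {P : Set p} → Dec P → ℕ
𝟙 (yes _) = 1
𝟙 (no _)  = 0

𝟙-yes : ∀ {p} {P : Set p} (P? : Dec P) → P → 𝟙 P? ≡ 1
𝟙-yes (yes _) _  = refl
𝟙-yes (no ¬p) p  = ⊥-elim (¬p p)

𝟙-no : ∀ {p} {P : Set p} (P? : Dec P) → ¬ P → 𝟙 P? ≡ 0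
𝟙-no (yes p) ¬p = ⊥-elim (¬p p)
𝟙-no (no _)  _  = refl

𝟙-⇔ : ∀ {p q} {P : Set p} {Q : Set q} (P? : Dec P) (Q? : Dec Q) → (P → Q) → (Q → P) → 𝟙 P? ≡ 𝟙 Q?
𝟙-⇔ (yes p) Q? P→Q Q→P = sym (𝟙-yes Q? (P→Q p))
𝟙-⇔ (no ¬p) Q? P→Q Q→P = sym (𝟙-no Q? (¬p ∘ Q→P))

𝟙-<-suc : ∀ h y → 𝟙 (h <? suc y) ≡ 𝟙 (h <? y) + 𝟙 (h ≟ y)
𝟙-<-suc h y with h <? suc y | h <? y | h ≟ y
... | yes _    | yes h<y | yes refl = ⊥-elim (<-irrefl refl h<y)
... | yes _    | yes _   | no  _    = refl
... | yes _    | no  _   | yes _    = refl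
... | yes h≤y  | no  h≮y | no  h≢y  = ⊥-elim (h≢y (≤-antisym (s≤s⁻¹ h≤y) (≮⇒≥ h≮y)))
... | no  h≰y  | yes h<y | _        = ⊥-elim (h≰y (m<n⇒m<1+n h<y))
... | no  h≰y  | no  _   | yes refl = ⊥-elim (h≰y ≤-refl)
... | no  _    | no  _   | no  _    = refl

𝟙-×-dec+1 : ∀ {p q} {P : Set p} {Q : Set q} (P? : Dec P) (Q? : Dec Q) →
            P ⊎ Q → 𝟙 (P? ×-dec Q?) + 1 ≡ 𝟙 P? + 𝟙 Q?
𝟙-×-dec+1 (yes _) (yes _) _        = refl
𝟙-×-dec+1 (yes _) (no  _) _        = refl
𝟙-×-dec+1 (no  _) (yes _) _        = refl
𝟙-×-dec+1 (no ¬p) (no ¬q) (inj₁ p) = ⊥-elim (¬p p)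
𝟙-×-dec+1 (no ¬p) (no ¬q) (inj₂ q) = ⊥-elim (¬q q)

∑<-indicator : ∀ K (F : ℕ → ℕ) h → h < K → ∑[ y < K ] (F y * 𝟙 (h ≟ y)) ≡ F h
∑<-indicator (suc K) F h (s≤s h≤K) with h ≟ K
... | yes refl = begin
  ∑[ y < h ] (F y * 𝟙 (h ≟ y)) + F h * 1 ≡⟨ cong₂ _+_ earlier-vanish (*-identityʳ (F h)) ⟩
  0 + F h                                ∎
  where
  earlier-vanish : ∑[ y < h ] (F y * 𝟙 (h ≟ y)) ≡ 0
  earlier-vanish = trans
    (∑<-cong h {g = λ _ → 0} (λ y y<h →
      trans (cong (F y *_) (𝟙-no (h ≟ y) (λ h≡y → <-irrefl (sym h≡y) y<h))) (*-zeroʳ (F y))))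
    (∑<-zero h)
... | no h≢K = trans (cong₂ _+_ (∑<-indicator K F h (≤∧≢⇒< h≤K h≢K)) (*-zeroʳ (F K))) (+-identityʳ (F h))

module _ {A : Set} where

  ∑∈ : List A → (A → ℕ) → ℕ
  ∑∈ []       f = 0
  ∑∈ (x ∷ xs) f = f x + ∑∈ xs f

  infixr 6.5 ∑∈
  syntax ∑∈ xs (λ x → e) = ∑[ x ∈ xs ] e

  ∑∈-cong : ∀ xs {f g : A → ℕ} → f ≗ g → ∑[ x ∈ xs ] f x ≡ ∑[ x ∈ xs ] g x
  ∑∈-cong []       f≗g = refl
  ∑∈-cong (x ∷ xs) f≗g = cong₂ _+_ (f≗g x) (∑∈-cong xs f≗g)

  ∑∈-congᴬ : ∀ {xs} {f g : A → ℕ} → All (λ x → f x ≡ g x) xs → ∑[ x ∈ xs ] f x ≡ ∑[ x ∈ xs ] g x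
  ∑∈-congᴬ []             = refl
  ∑∈-congᴬ (fx≡gx ∷ f≡g) = cong₂ _+_ fx≡gx (∑∈-congᴬ f≡g)

  ∑∈-zero : ∀ xs → ∑[ x ∈ xs ] 0 ≡ 0
  ∑∈-zero []       = refl
  ∑∈-zero (x ∷ xs) = ∑∈-zero xs

  ∑∈-++ : ∀ xs ys (f : A → ℕ) → ∑[ x ∈ xs ++ ys ] f x ≡ ∑[ x ∈ xs ] f x + ∑[ x ∈ ys ] f x
  ∑∈-++ []       ys f = refl
  ∑∈-++ (x ∷ xs) ys f = trans (cong (f x +_) (∑∈-++ xs ys f)) (sym (+-assoc (f x) _ _))

  ∑∈-+ : ∀ xs (f g : A → ℕ) → ∑[ x ∈ xs ] (f x + g x) ≡ ∑[ x ∈ xs ] f x + ∑[ x ∈ xs ] g x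
  ∑∈-+ []       f g = refl
  ∑∈-+ (x ∷ xs) f g = trans (cong (f x + g x +_) (∑∈-+ xs f g)) (interchange (f x) (g x) _ _)

  ∑∈-const : ∀ xs c → ∑[ x ∈ xs ] c ≡ length xs * c
  ∑∈-const []       c = refl
  ∑∈-const (x ∷ xs) c = cong (c +_) (∑∈-const xs c)

  ∑∈-filter : ∀ {P : A → Set} (P? : ∀ x → Dec (P x)) xs (f : A → ℕ) →
              ∑[ x ∈ filter P? xs ] f x ≡ ∑[ x ∈ xs ] (𝟙 (P? x) * f x)
  ∑∈-filter P? []       f = refl
  ∑∈-filter P? (x ∷ xs) f with P? x
  ... | yes _ = cong₂ _+_ (sym (+-identityʳ (f x))) (∑∈-filter P? xs f)
  ... | no  _ = ∑∈-filter P? xs f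

  length-filter : ∀ {P : A → Set} (P? : ∀ x → Dec (P x)) xs → length (filter P? xs) ≡ ∑[ x ∈ xs ] 𝟙 (P? x)
  length-filter P? []       = refl
  length-filter P? (x ∷ xs) with P? x
  ... | yes _ = cong suc (length-filter P? xs)
  ... | no  _ = length-filter P? xs

  ∑∈-byValue : ∀ (g : A → ℕ) K (F : ℕ → ℕ) xs → All (λ x → g x < K) xs →
               ∑[ x ∈ xs ] F (g x) ≡ ∑[ y < K ] (F y * (∑[ x ∈ xs ] 𝟙 (g x ≟ y)))
  ∑∈-byValue g K F []       []           = sym (trans (∑<-cong K (λ y _ → *-zeroʳ (F y))) (∑<-zero K))
  ∑∈-byValue g K F (x ∷ xs) (gx<K ∷ g<K) = begin
    F (g x) + ∑[ x ∈ xs ] F (g x)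
      ≡⟨ cong₂ _+_ (sym (∑<-indicator K F (g x) gx<K)) (∑∈-byValue g K F xs g<K) ⟩
    ∑[ y < K ] (F y * 𝟙 (g x ≟ y)) + ∑[ y < K ] (F y * (∑[ x ∈ xs ] 𝟙 (g x ≟ y)))
      ≡⟨ sym (∑<-+ K _ _) ⟩
    ∑[ y < K ] (F y * 𝟙 (g x ≟ y) + F y * (∑[ x ∈ xs ] 𝟙 (g x ≟ y)))
      ≡⟨ ∑<-cong K (λ y _ → sym (*-distribˡ-+ (F y) _ _)) ⟩
    ∑[ y < K ] (F y * (∑[ x ∈ x ∷ xs ] 𝟙 (g x ≟ y))) ∎

module _ {A B : Set} where

  ∑∈-concatMap : ∀ (g : A → List B) xs (f : B → ℕ) →
                 ∑[ y ∈ concatMap g xs ] f y ≡ ∑[ x ∈ xs ] ∑[ y ∈ g x ] f y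
  ∑∈-concatMap g []       f = refl
  ∑∈-concatMap g (x ∷ xs) f = trans (∑∈-++ (g x) (concatMap g xs) f) (cong (∑∈ (g x) f +_) (∑∈-concatMap g xs f))

  ∑∈-swap : ∀ xs ys (F : A → B → ℕ) → ∑[ x ∈ xs ] ∑[ y ∈ ys ] F x y ≡ ∑[ y ∈ ys ] ∑[ x ∈ xs ] F x y
  ∑∈-swap []       ys F = sym (∑∈-zero ys)
  ∑∈-swap (x ∷ xs) ys F = trans (cong (∑[ y ∈ ys ] F x y +_) (∑∈-swap xs ys F))
    (sym (∑∈-+ ys (F x) (λ y → ∑[ x ∈ xs ] F x y)))

∑∈-pairs : ∀ {A B : Set} xs ys (f : A × B → ℕ) →
           ∑[ xy ∈ concatMap (λ x → concatMap (λ y → (x , y) ∷ []) ys) xs ] f xy ≡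
           ∑[ x ∈ xs ] ∑[ y ∈ ys ] f (x , y)
∑∈-pairs xs ys f = trans (∑∈-concatMap _ xs f) (∑∈-cong xs (λ x →
  trans (∑∈-concatMap _ ys f) (∑∈-cong ys (λ y → +-identityʳ (f (x , y))))))

∑∈-applyUpTo : ∀ (g f : ℕ → ℕ) n → ∑[ k ∈ applyUpTo g n ] f k ≡ ∑[ k < n ] f (g k)
∑∈-applyUpTo g f zero    = refl
∑∈-applyUpTo g f (suc n) = trans (cong (f (g 0) +_) (∑∈-applyUpTo (g ∘ suc) f n)) (sym (∑<-suc n (f ∘ g)))

-- Formal power series

Series : Set
Series = ℕ → ℕ

infixl 6 _⊕_
infixl 7 _∗_

_⊕_ : Series → Series → Series
(f ⊕ g) n = f n + g n

tail : Series → Series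
tail f n = f (suc n)

_∗_ : Series → Series → Series
(f ∗ g) zero    = f 0 * g 0
(f ∗ g) (suc n) = f 0 * g (suc n) + (tail f ∗ g) n

one : Series
one zero    = 1
one (suc _) = 0

shift : Series → Series
shift f zero    = 0
shift f (suc n) = f n

shift² : Series → Series
shift² f = shift (shift f)

∗-cong : ∀ n {f f′ g g′ : Series} → (∀ i → i ≤ n → f i ≡ f′ i) → (∀ i → i ≤ n → g i ≡ g′ i) →
         (f ∗ g) n ≡ (f′ ∗ g′) n
∗-cong zero    f≡ g≡ = cong₂ _*_ (f≡ 0 z≤n) (g≡ 0 z≤n)
∗-cong (suc n) f≡ g≡ = cong₂ _+_ (cong₂ _*_ (f≡ 0 z≤n) (g≡ (suc n) ≤-refl))
  (∗-cong n (λ i i≤n → f≡ (suc i) (s≤s i≤n)) (λ i i≤n → g≡ i (m≤n⇒m≤1+n i≤n)))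

∗-congˡ : ∀ {f f′} g → f ≗ f′ → f ∗ g ≗ f′ ∗ g
∗-congˡ g f≗f′ n = ∗-cong n (λ i _ → f≗f′ i) (λ _ _ → refl)

∗-congʳ : ∀ f {g g′} → g ≗ g′ → f ∗ g ≗ f ∗ g′
∗-congʳ f g≗g′ n = ∗-cong n (λ _ _ → refl) (λ i _ → g≗g′ i)

shift-cong : ∀ {f g} → f ≗ g → shift f ≗ shift g
shift-cong f≗g zero    = refl
shift-cong f≗g (suc n) = f≗g n

shift-⊕ : ∀ f g → shift (f ⊕ g) ≗ shift f ⊕ shift g
shift-⊕ f g zero    = refl
shift-⊕ f g (suc n) = refl

∗-distribʳ-⊕ : ∀ f g h → (f ⊕ g) ∗ h ≗ f ∗ h ⊕ g ∗ h
∗-distribʳ-⊕ f g h zero    = *-distribʳ-+ (h 0) (f 0) (g 0)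
∗-distribʳ-⊕ f g h (suc n) = trans
  (cong₂ _+_ (*-distribʳ-+ (h (suc n)) (f 0) (g 0)) (∗-distribʳ-⊕ (tail f) (tail g) h n))
  (interchange (f 0 * h (suc n)) (g 0 * h (suc n)) _ _)

∗-distribˡ-⊕ : ∀ f g h → f ∗ (g ⊕ h) ≗ f ∗ g ⊕ f ∗ h
∗-distribˡ-⊕ f g h zero    = *-distribˡ-+ (f 0) (g 0) (h 0)
∗-distribˡ-⊕ f g h (suc n) = trans
  (cong₂ _+_ (*-distribˡ-+ (f 0) (g (suc n)) (h (suc n))) (∗-distribˡ-⊕ (tail f) g h n))
  (interchange (f 0 * g (suc n)) (f 0 * h (suc n)) _ _)

∗-scaleˡ : ∀ c f g → (λ i → c * f i) ∗ g ≗ (λ n → c * (f ∗ g) n)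
∗-scaleˡ c f g zero    = *-assoc c (f 0) (g 0)
∗-scaleˡ c f g (suc n) = trans
  (cong₂ _+_ (*-assoc c (f 0) (g (suc n))) (∗-scaleˡ c (tail f) g n))
  (sym (*-distribˡ-+ c _ _))

∗-zeroˡ : ∀ g → (λ _ → 0) ∗ g ≗ (λ _ → 0)
∗-zeroˡ g zero    = refl
∗-zeroˡ g (suc n) = ∗-zeroˡ g n

∗-identityˡ : ∀ g → one ∗ g ≗ g
∗-identityˡ g zero    = +-identityʳ (g 0)
∗-identityˡ g (suc n) = begin
  g (suc n) + 0 + ((λ _ → 0) ∗ g) n ≡⟨ cong (g (suc n) + 0 +_) (∗-zeroˡ g n) ⟩
  g (suc n) + 0 + 0                  ≡⟨ +-identityʳ _ ⟩
  g (suc n) + 0                      ≡⟨ +-identityʳ _ ⟩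
  g (suc n)                          ∎

shift-∗ : ∀ f g → shift f ∗ g ≗ shift (f ∗ g)
shift-∗ f g zero    = refl
shift-∗ f g (suc n) = refl

∗-unfoldʳ : ∀ f g n → (f ∗ g) (suc n) ≡ (f ∗ tail g) n + f (suc n) * g 0
∗-unfoldʳ f g zero    = refl
∗-unfoldʳ f g (suc n) = begin
  f 0 * g (suc (suc n)) + (tail f ∗ g) (suc n)
    ≡⟨ cong (f 0 * g (suc (suc n)) +_) (∗-unfoldʳ (tail f) g n) ⟩
  f 0 * g (suc (suc n)) + ((tail f ∗ tail g) n + f (suc (suc n)) * g 0)
    ≡⟨ sym (+-assoc (f 0 * g (suc (suc n))) _ _) ⟩
  f 0 * g (suc (suc n)) + (tail f ∗ tail g) n + f (suc (suc n)) * g 0 ∎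

∗-unfoldˡ : ∀ f g → f ∗ g ≗ (λ n → f 0 * g n) ⊕ shift (tail f ∗ g)
∗-unfoldˡ f g zero    = sym (+-identityʳ (f 0 * g 0))
∗-unfoldˡ f g (suc n) = refl

∗-comm : ∀ f g → f ∗ g ≗ g ∗ f
∗-comm f g zero    = *-comm (f 0) (g 0)
∗-comm f g (suc n) = begin
  f 0 * g (suc n) + (tail f ∗ g) n ≡⟨ cong (f 0 * g (suc n) +_) (∗-comm (tail f) g n) ⟩
  f 0 * g (suc n) + (g ∗ tail f) n ≡⟨ +-comm (f 0 * g (suc n)) _ ⟩
  (g ∗ tail f) n + f 0 * g (suc n) ≡⟨ cong ((g ∗ tail f) n +_) (*-comm (f 0) (g (suc n))) ⟩
  (g ∗ tail f) n + g (suc n) * f 0 ≡⟨ sym (∗-unfoldʳ g f n) ⟩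
  (g ∗ f) (suc n)                  ∎

∗-identityʳ : ∀ f → f ∗ one ≗ f
∗-identityʳ f n = trans (∗-comm f one n) (∗-identityˡ f n)

∗-shift : ∀ f g → f ∗ shift g ≗ shift (f ∗ g)
∗-shift f g n = begin
  (f ∗ shift g) n   ≡⟨ ∗-comm f (shift g) n ⟩
  (shift g ∗ f) n   ≡⟨ shift-∗ g f n ⟩
  shift (g ∗ f) n   ≡⟨ shift-cong (∗-comm g f) n ⟩
  shift (f ∗ g) n   ∎

∗-assoc : ∀ f g h → (f ∗ g) ∗ h ≗ f ∗ (g ∗ h)
∗-assoc f g h zero    = *-assoc (f 0) (g 0) (h 0)
∗-assoc f g h (suc n) = begin
  f 0 * g 0 * h (suc n) + (tail (f ∗ g) ∗ h) n
    ≡⟨ cong (f 0 * g 0 * h (suc n) +_) (trans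
         (∗-distribʳ-⊕ (λ i → f 0 * g (suc i)) (tail f ∗ g) h n)
         (cong₂ _+_ (∗-scaleˡ (f 0) (tail g) h n) (∗-assoc (tail f) g h n))) ⟩
  f 0 * g 0 * h (suc n) + (f 0 * (tail g ∗ h) n + (tail f ∗ (g ∗ h)) n)
    ≡⟨ sym (+-assoc (f 0 * g 0 * h (suc n)) _ _) ⟩
  f 0 * g 0 * h (suc n) + f 0 * (tail g ∗ h) n + (tail f ∗ (g ∗ h)) n
    ≡⟨ cong (_+ (tail f ∗ (g ∗ h)) n) (trans
         (cong (_+ f 0 * (tail g ∗ h) n) (*-assoc (f 0) (g 0) (h (suc n))))
         (sym (*-distribˡ-+ (f 0) _ _))) ⟩
  f 0 * (g ∗ h) (suc n) + (tail f ∗ (g ∗ h)) n ∎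

∗-shift² : ∀ f g → f ∗ shift² g ≗ shift² (f ∗ g)
∗-shift² f g n = trans (∗-shift f (shift g) n) (shift-cong (∗-shift f g) n)

shift²-∗ : ∀ f g → shift² f ∗ g ≗ shift² (f ∗ g)
shift²-∗ f g n = trans (shift-∗ (shift f) g n) (shift-cong (shift-∗ f g) n)

∗-one⊕shift²ʳ : ∀ f {v} w → v ≗ one ⊕ shift² w → f ∗ v ≗ f ⊕ shift² (f ∗ w)
∗-one⊕shift²ʳ f {v} w v≗ n = begin
  (f ∗ v) n                          ≡⟨ ∗-congʳ f v≗ n ⟩
  (f ∗ (one ⊕ shift² w)) n           ≡⟨ ∗-distribˡ-⊕ f one (shift² w) n ⟩
  (f ∗ one) n + (f ∗ shift² w) n     ≡⟨ cong₂ _+_ (∗-identityʳ f n) (∗-shift² f w n) ⟩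
  f n + shift² (f ∗ w) n             ∎

∗-one⊕shift²ˡ : ∀ {t} w g → t ≗ one ⊕ shift² w → t ∗ g ≗ g ⊕ shift² (w ∗ g)
∗-one⊕shift²ˡ {t} w g t≗ n = begin
  (t ∗ g) n                          ≡⟨ ∗-congˡ g t≗ n ⟩
  ((one ⊕ shift² w) ∗ g) n           ≡⟨ ∗-distribʳ-⊕ one (shift² w) g n ⟩
  (one ∗ g) n + (shift² w ∗ g) n     ≡⟨ cong₂ _+_ (∗-identityˡ g n) (shift²-∗ w g n) ⟩
  g n + shift² (w ∗ g) n             ∎

-- Expanding t v through either equation gives v + x²stv = t + x²stv + x²etv,
-- hence e′ = x²etv, and expanding e v through the second one gives e + x²etv.
∗-increment : ∀ s t v e e′ → t ≗ one ⊕ shift² (s ∗ t) → v ≗ one ⊕ shift² (t ∗ v) →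
              t ≗ s ⊕ e → v ≗ t ⊕ e′ → e ∗ v ≗ e ⊕ e′
∗-increment s t v e e′ t≗ v≗ t≗s⊕e v≗t⊕e′ n = begin
  (e ∗ v) n                          ≡⟨ ∗-one⊕shift²ʳ e (t ∗ v) v≗ n ⟩
  e n + Y n                          ≡⟨ cong (e n +_) (Y≡e′ n) ⟩
  e n + e′ n                         ∎
  where
  X Y : Series
  X = shift² (s ∗ (t ∗ v))
  Y = shift² (e ∗ (t ∗ v))

  tv-via-t : t ∗ v ≗ v ⊕ X
  tv-via-t m = trans (∗-one⊕shift²ˡ (s ∗ t) v t≗ m) (cong (v m +_) (shift-cong (shift-cong (∗-assoc s t v)) m))

  tv-via-v : t ∗ v ≗ t ⊕ (X ⊕ Y)
  tv-via-v m = begin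
    (t ∗ v) m
      ≡⟨ ∗-one⊕shift²ʳ t (t ∗ v) v≗ m ⟩
    t m + shift² (t ∗ (t ∗ v)) m
      ≡⟨ cong (t m +_) (shift-cong (shift-cong split) m) ⟩
    t m + shift² (s ∗ (t ∗ v) ⊕ e ∗ (t ∗ v)) m
      ≡⟨ cong (t m +_) (trans (shift-cong (shift-⊕ _ _) m) (shift-⊕ _ _ m)) ⟩
    t m + (X m + Y m) ∎
    where
    split : t ∗ (t ∗ v) ≗ s ∗ (t ∗ v) ⊕ e ∗ (t ∗ v)
    split k = trans (∗-congˡ (t ∗ v) t≗s⊕e k) (∗-distribʳ-⊕ s e (t ∗ v) k)

  Y≡e′ : Y ≗ e′
  Y≡e′ m = +-cancelˡ-≡ (t m) (Y m) (e′ m) (+-cancelʳ-≡ (X m) (t m + Y m) (t m + e′ m) (begin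
    t m + Y m + X m     ≡⟨ trans (+-assoc (t m) _ _) (cong (t m +_) (+-comm (Y m) (X m))) ⟩
    t m + (X m + Y m)   ≡⟨ sym (tv-via-v m) ⟩
    (t ∗ v) m           ≡⟨ tv-via-t m ⟩
    v m + X m           ≡⟨ cong (_+ X m) (v≗t⊕e′ m) ⟩
    t m + e′ m + X m    ∎))

-- It suffices that F vanishes at odd indices: the odd terms of the convolution drop out.
∗-evenCoefficient : ∀ n F G → (∀ k → F (suc (2 * k)) ≡ 0) →
                    ∑[ k < suc n ] F (2 * k) * G (2 * (n ∸ k)) ≡ (F ∗ G) (2 * n)
∗-evenCoefficient zero    F G F-odd = refl
∗-evenCoefficient (suc n) F G F-odd = begin
  ∑[ k < suc (suc n) ] F (2 * k) * G (2 * (suc n ∸ k))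
    ≡⟨ ∑<-suc (suc n) _ ⟩
  F 0 * G (2 * suc n) + ∑[ k < suc n ] F (2 * suc k) * G (2 * (n ∸ k))
    ≡⟨ cong (F 0 * G (2 * suc n) +_) (∑<-cong (suc n) (λ k _ → cong (λ i → F i * G (2 * (n ∸ k))) (*-suc 2 k))) ⟩
  F 0 * G (2 * suc n) + ∑[ k < suc n ] F″ (2 * k) * G (2 * (n ∸ k))
    ≡⟨ cong (F 0 * G (2 * suc n) +_) (∗-evenCoefficient n F″ G F″-odd) ⟩
  F 0 * G (2 * suc n) + (F″ ∗ G) (2 * n)
    ≡⟨ cong (λ i → F 0 * G i + (F″ ∗ G) (2 * n)) (*-suc 2 n) ⟩
  F 0 * G (suc (suc (2 * n))) + (F″ ∗ G) (2 * n)
    ≡⟨ cong (λ z → F 0 * G (suc (suc (2 * n))) + (z * G (suc (2 * n)) + (F″ ∗ G) (2 * n))) (sym (F-odd 0)) ⟩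
  (F ∗ G) (suc (suc (2 * n)))
    ≡⟨ cong (F ∗ G) (sym (*-suc 2 n)) ⟩
  (F ∗ G) (2 * suc n) ∎
  where
  F″ : Series
  F″ = tail (tail F)
  F″-odd : ∀ k → F″ (suc (2 * k)) ≡ 0
  F″-odd k = trans (cong (F ∘ suc) (sym (*-suc 2 k))) (F-odd (suc k))

-- Walks and ballot numbers

-- walks m ℓ r counts step sequences of length m from level ℓ to level 0 that
-- stay within the strip [0, ℓ + r].
walks : ℕ → ℕ → ℕ → ℕ
walks zero    zero    r       = 1
walks zero    (suc ℓ) r       = 0
walks (suc m) zero    zero    = 0
walks (suc m) zero    (suc r) = walks m 1 r
walks (suc m) (suc ℓ) zero    = walks m ℓ 1
walks (suc m) (suc ℓ) (suc r) = walks m (suc (suc ℓ)) r + walks m ℓ (suc (suc r))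

walksFrom : ℕ → ℕ → Series
walksFrom ℓ r m = walks m ℓ r

walksFrom-0-0 : walksFrom 0 0 ≗ one
walksFrom-0-0 zero    = refl
walksFrom-0-0 (suc m) = refl

FirstPassage : ℕ → Set
FirstPassage m = ∀ ℓ r → walks m (suc ℓ) r ≡ shift (walksFrom 0 r ∗ walksFrom ℓ (suc r)) m

-- A walk from ℓ + 1 splits at its first visit to level ℓ into a walk from
-- ℓ + 1 back to ℓ + 1 above ℓ, a down step, and a walk from ℓ.
walks-firstPassage : ∀ m → FirstPassage m
walks-firstPassage = <-rec FirstPassage step
  where
  step : ∀ m → (∀ {k} → k < m → FirstPassage k) → FirstPassage m
  step zero    _  ℓ r       = refl
  step (suc m) _  ℓ zero    =
    sym (trans (∗-congˡ (walksFrom ℓ 1) walksFrom-0-0 m) (∗-identityˡ (walksFrom ℓ 1) m))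
  step (suc m) ih ℓ (suc r) = begin
    walks m (suc (suc ℓ)) r + g m       ≡⟨ +-comm _ (g m) ⟩
    g m + walks m (suc (suc ℓ)) r       ≡⟨ cong₂ _+_ (sym (*-identityˡ (g m))) (after-up m ≤-refl) ⟩
    1 * g m + shift (tail f ∗ g) m      ≡⟨ sym (∗-unfoldˡ f g m) ⟩
    (f ∗ g) m                           ∎
    where
    f g : Series
    f = walksFrom 0 (suc r)
    g = walksFrom ℓ (suc (suc r))

    ih≤ : ∀ {i} → i ≤ m → FirstPassage i
    ih≤ i≤m = ih (s≤s i≤m)

    after-up : ∀ k → k ≤ m → walks k (suc (suc ℓ)) r ≡ shift (tail f ∗ g) k
    after-up zero    _   = refl
    after-up (suc k) k<m = begin
      walks (suc k) (suc (suc ℓ)) r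
        ≡⟨ ih≤ k<m (suc ℓ) r ⟩
      (walksFrom 0 r ∗ walksFrom (suc ℓ) (suc r)) k
        ≡⟨ ∗-cong k (λ _ _ → refl) (λ i i≤k → ih≤ (≤-trans i≤k k≤m) ℓ (suc r)) ⟩
      (walksFrom 0 r ∗ shift (f ∗ g)) k
        ≡⟨ ∗-shift (walksFrom 0 r) (f ∗ g) k ⟩
      shift (walksFrom 0 r ∗ (f ∗ g)) k
        ≡⟨ shift-cong (λ j → sym (∗-assoc (walksFrom 0 r) f g j)) k ⟩
      shift ((walksFrom 0 r ∗ f) ∗ g) k
        ≡⟨ sym (shift-∗ (walksFrom 0 r ∗ f) g k) ⟩
      (shift (walksFrom 0 r ∗ f) ∗ g) k
        ≡⟨ ∗-cong k (λ i i≤k → sym (ih≤ (≤-trans i≤k k≤m) 0 r)) (λ _ _ → refl) ⟩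
      (tail f ∗ g) k ∎
      where
      k≤m : k ≤ m
      k≤m = ≤-trans (n≤1+n k) k<m

walks-mono : ∀ m ℓ r → walks m ℓ r ≤ walks m ℓ (suc r)
walks-mono zero    zero    r       = ≤-refl
walks-mono zero    (suc ℓ) r       = ≤-refl
walks-mono (suc m) zero    zero    = z≤n
walks-mono (suc m) zero    (suc r) = walks-mono m 1 r
walks-mono (suc m) (suc ℓ) zero    = ≤-trans (walks-mono m ℓ 1) (m≤n+m _ _)
walks-mono (suc m) (suc ℓ) (suc r) = +-mono-≤ (walks-mono m (suc (suc ℓ)) r) (walks-mono m ℓ (suc (suc r)))

parity-suc : ∀ n → parity (suc n) ≡ parity n ⁻¹
parity-suc n = sym (⁻¹-selfInverse (suc-homo-⁻¹ n))

parity-cong-suc : ∀ {m n} → parity m ≡ parity n → parity (suc m) ≡ parity (suc n)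
parity-cong-suc {m} {n} eq = trans (parity-suc m) (trans (cong _⁻¹ eq) (sym (parity-suc n)))

walks-parity : ∀ m ℓ r → parity m ≢ parity ℓ → walks m ℓ r ≡ 0
walks-parity zero    zero    r       m≢ℓ = ⊥-elim (m≢ℓ refl)
walks-parity zero    (suc ℓ) r       m≢ℓ = refl
walks-parity (suc m) zero    zero    m≢ℓ = refl
walks-parity (suc m) zero    (suc r) m≢ℓ = walks-parity m 1 r (m≢ℓ ∘ parity-cong-suc {m} {1})
walks-parity (suc m) (suc ℓ) zero    m≢ℓ = walks-parity m ℓ 1 (m≢ℓ ∘ parity-cong-suc {m} {ℓ})
walks-parity (suc m) (suc ℓ) (suc r) m≢ℓ = cong₂ _+_
  (walks-parity m (suc (suc ℓ)) r (m≢ℓ ∘ parity-cong-suc {m} {ℓ}))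
  (walks-parity m ℓ (suc (suc r)) (m≢ℓ ∘ parity-cong-suc {m} {ℓ}))

walks-odd : ∀ k r → walks (suc (2 * k)) 0 r ≡ 0
walks-odd k r = walks-parity (suc (2 * k)) 0 r odd≢even
  where
  odd≢even : parity (suc (2 * k)) ≢ 0ℙ
  odd≢even eq with trans (sym eq) (trans (parity-suc (2 * k)) (cong _⁻¹ (*-homo-* 2 k)))
  ... | ()

ballot : ℕ → ℕ → ℕ
ballot zero    zero    = 1
ballot zero    (suc ℓ) = 0
ballot (suc m) zero    = ballot m 1
ballot (suc m) (suc ℓ) = ballot m (suc (suc ℓ)) + ballot m ℓ

walks-ballot : ∀ m ℓ r → m ≤ r → walks m ℓ r ≡ ballot m ℓ
walks-ballot zero    zero    r       _         = refl
walks-ballot zero    (suc ℓ) r       _         = refl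
walks-ballot (suc m) zero    (suc r) (s≤s m≤r) = walks-ballot m 1 r m≤r
walks-ballot (suc m) (suc ℓ) (suc r) (s≤s m≤r) = cong₂ _+_
  (walks-ballot m (suc (suc ℓ)) r m≤r)
  (walks-ballot m ℓ (suc (suc r)) (≤-trans m≤r (m≤n+m r 2)))

ballot-unreachable : ∀ m ℓ → m < ℓ → ballot m ℓ ≡ 0
ballot-unreachable zero    (suc ℓ) _         = refl
ballot-unreachable (suc m) (suc ℓ) (s≤s m<ℓ) = cong₂ _+_
  (ballot-unreachable m (suc (suc ℓ)) (≤-trans m<ℓ (m≤n+m ℓ 2)))
  (ballot-unreachable m ℓ m<ℓ)

ballot-diagonal : ∀ ℓ → ballot ℓ ℓ ≡ 1
ballot-diagonal zero    = refl
ballot-diagonal (suc ℓ) = cong₂ _+_ (ballot-unreachable ℓ (suc (suc ℓ)) (m<n⇒m<1+n (n<1+n ℓ))) (ballot-diagonal ℓ)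

ballot-formula : ∀ j ℓ → ballot (ℓ + (j + j)) ℓ * (j ! * suc (ℓ + j) !) ≡ suc ℓ * (ℓ + (j + j)) !
ballot-formula zero ℓ rewrite +-identityʳ ℓ | ballot-diagonal ℓ =
  trans (*-identityˡ _) (*-identityˡ _)
ballot-formula (suc j) zero = subst
  (λ x → ballot (suc x) 0 * (suc j ! * suc (suc j) !) ≡ 1 * (suc x) !)
  (sym (+-suc j j))
  (up-first (ballot-formula j 1))
  where
  up-first : ballot (suc (j + j)) 1 * (j ! * suc (suc j) !) ≡ 2 * suc (j + j) ! →
             ballot (suc (j + j)) 1 * (suc j ! * suc (suc j) !) ≡ 1 * suc (suc (j + j)) !
  up-first ih = begin
    B * ((suc j * J) * K)     ≡⟨ rearrange B J K j ⟩
    suc j * (B * (J * K))     ≡⟨ cong (suc j *_) ih ⟩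
    suc j * (2 * F)           ≡⟨ double j F ⟩
    1 * (suc (suc (j + j)) * F) ∎
    where
    B J K F : ℕ
    B = ballot (suc (j + j)) 1
    J = j !
    K = suc (suc j) !
    F = suc (j + j) !
    rearrange : ∀ B J K j → B * ((suc j * J) * K) ≡ suc j * (B * (J * K))
    rearrange = solve-∀
    double : ∀ j F → suc j * (2 * F) ≡ 1 * (suc (suc (j + j)) * F)
    double = solve-∀
ballot-formula (suc j) (suc ℓ) = subst₂
  (λ x y → ballot (suc x) (suc ℓ) * (suc j ! * suc (suc y) !) ≡ suc (suc ℓ) * (suc x) !)
  (sym index) (sym (+-suc ℓ j))
  (up-or-down (ballot-formula j (suc (suc ℓ)))
              (subst₂ (λ x y → ballot x ℓ * (suc j ! * suc y !) ≡ suc ℓ * x !)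
                      index (+-suc ℓ j) (ballot-formula (suc j) ℓ)))
  where
  index : ℓ + (suc j + suc j) ≡ suc (suc (ℓ + (j + j)))
  index = trans (+-suc ℓ (j + suc j)) (cong suc (trans (cong (ℓ +_) (+-suc j j)) (+-suc ℓ (j + j))))

  M A B J K : ℕ
  M = suc (suc (ℓ + (j + j)))
  A = ballot M (suc (suc ℓ))
  B = ballot M ℓ
  J = j !
  K = suc (suc (ℓ + j)) !

  up-or-down : A * (J * (suc (suc (suc (ℓ + j))) * K)) ≡ suc (suc (suc ℓ)) * M ! →
               B * ((suc j * J) * K) ≡ suc ℓ * M ! →
               (A + B) * ((suc j * J) * (suc (suc (suc (ℓ + j))) * K)) ≡ suc (suc ℓ) * (suc M * M !)
  up-or-down ihA ihB = begin
    (A + B) * ((suc j * J) * (suc (suc (suc (ℓ + j))) * K))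
      ≡⟨ distribute A B J K ℓ j ⟩
    suc j * (A * (J * (suc (suc (suc (ℓ + j))) * K))) + suc (suc (suc (ℓ + j))) * (B * ((suc j * J) * K))
      ≡⟨ cong₂ _+_ (cong (suc j *_) ihA) (cong (suc (suc (suc (ℓ + j))) *_) ihB) ⟩
    suc j * (suc (suc (suc ℓ)) * M !) + suc (suc (suc (ℓ + j))) * (suc ℓ * M !)
      ≡⟨ collect (M !) ℓ j ⟩
    suc (suc ℓ) * (suc M * M !) ∎
    where
    distribute : ∀ A B J K ℓ j → (A + B) * ((suc j * J) * (suc (suc (suc (ℓ + j))) * K)) ≡
                 suc j * (A * (J * (suc (suc (suc (ℓ + j))) * K))) + suc (suc (suc (ℓ + j))) * (B * ((suc j * J) * K))
    distribute = solve-∀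
    collect : ∀ F ℓ j → suc j * (suc (suc (suc ℓ)) * F) + suc (suc (suc (ℓ + j))) * (suc ℓ * F) ≡
              suc (suc ℓ) * (suc (suc (suc (ℓ + (j + j)))) * F)
    collect = solve-∀

catalan : ℕ → ℕ
catalan n = ballot (2 * n) 0

catalan-formula : ∀ n → catalan n * (n ! * suc n !) ≡ (2 * n) !
catalan-formula n = subst (λ m → ballot m 0 * (n ! * suc n !) ≡ m !)
  (cong (n +_) (sym (+-identityʳ n)))
  (trans (ballot-formula n 0) (+-identityʳ _))

-- Dyck paths by height

-- dyck< y m counts the Dyck step sequences of length m (not semilength) and
-- height below y.
dyck< : ℕ → Series
dyck< zero    _ = 0
dyck< (suc y)   = walksFrom 0 y

dyck<-firstReturn : ∀ y → dyck< (suc y) ≗ one ⊕ shift² (dyck< y ∗ dyck< (suc y))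
dyck<-firstReturn zero    zero          = refl
dyck<-firstReturn zero    (suc zero)    = refl
dyck<-firstReturn zero    (suc (suc m)) = sym (∗-zeroˡ (dyck< 1) m)
dyck<-firstReturn (suc y) zero          = refl
dyck<-firstReturn (suc y) (suc zero)    = refl
dyck<-firstReturn (suc y) (suc (suc m)) = walks-firstPassage (suc m) 0 y

dyck<-mono : ∀ y m → dyck< y m ≤ dyck< (suc y) m
dyck<-mono zero    m = z≤n
dyck<-mono (suc y) m = walks-mono m 0 y

dyckExact : ℕ → Series
dyckExact y m = dyck< (suc y) m ∸ dyck< y m

dyck<-suc : ∀ y → dyck< (suc y) ≗ dyck< y ⊕ dyckExact y
dyck<-suc y m = sym (m+[n∸m]≡n (dyck<-mono y m))

dyckExact-∗ : ∀ y → dyckExact y ∗ dyck< (suc (suc y)) ≗ dyckExact y ⊕ dyckExact (suc y)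
dyckExact-∗ y = ∗-increment (dyck< y) (dyck< (suc y)) (dyck< (suc (suc y))) (dyckExact y) (dyckExact (suc y))
  (dyck<-firstReturn y) (dyck<-firstReturn (suc y)) (dyck<-suc y) (dyck<-suc (suc y))

dyck<-odd : ∀ y k → dyck< y (suc (2 * k)) ≡ 0
dyck<-odd zero    k = refl
dyck<-odd (suc y) k = walks-odd k y

dyck<-ballot : ∀ y m → m < y → dyck< y m ≡ ballot m 0
dyck<-ballot (suc y) m (s≤s m≤y) = walks-ballot m 0 y m≤y

dyckExact-telescope : ∀ K m → ∑[ y < K ] dyckExact y m ≡ dyck< K m
dyckExact-telescope zero    m = refl
dyckExact-telescope (suc K) m = trans (cong (_+ dyckExact K m) (dyckExact-telescope K m)) (sym (dyck<-suc K m))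

∑-dyckExact-∗ : ∀ K m → ∑[ y < K ] (dyckExact y ∗ dyck< (suc (suc y))) m + dyckExact 0 m ≡ dyck< K m + dyck< (suc K) m
∑-dyckExact-∗ K m = begin
  ∑[ y < K ] (dyckExact y ∗ dyck< (suc (suc y))) m + dyckExact 0 m
    ≡⟨ cong (_+ dyckExact 0 m) (∑<-cong K (λ y _ → dyckExact-∗ y m)) ⟩
  ∑[ y < K ] (dyckExact y m + dyckExact (suc y) m) + dyckExact 0 m
    ≡⟨ cong (_+ dyckExact 0 m) (∑<-+ K _ _) ⟩
  ∑[ y < K ] dyckExact y m + ∑[ y < K ] dyckExact (suc y) m + dyckExact 0 m
    ≡⟨ +-assoc (∑[ y < K ] dyckExact y m) _ _ ⟩
  ∑[ y < K ] dyckExact y m + (∑[ y < K ] dyckExact (suc y) m + dyckExact 0 m)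
    ≡⟨ cong (∑[ y < K ] dyckExact y m +_) (trans (+-comm _ (dyckExact 0 m)) (sym (∑<-suc K (λ y → dyckExact y m)))) ⟩
  ∑[ y < K ] dyckExact y m + ∑[ y < suc K ] dyckExact y m
    ≡⟨ cong₂ _+_ (dyckExact-telescope K m) (dyckExact-telescope (suc K) m) ⟩
  dyck< K m + dyck< (suc K) m ∎

catalan-convolution : ∀ n → ∑[ k < suc n ] catalan k * catalan (n ∸ k) ≡ catalan (suc n)
catalan-convolution n = begin
  ∑[ k < suc n ] catalan k * catalan (n ∸ k)
    ≡⟨ ∑<-cong (suc n) (λ k k≤n → sym (cong₂ _*_ (dyck<-ballot y (2 * k) (first k≤n))
                                                 (dyck<-ballot (suc y) (2 * (n ∸ k)) (second k)))) ⟩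
  ∑[ k < suc n ] dyck< y (2 * k) * dyck< (suc y) (2 * (n ∸ k))
    ≡⟨ ∗-evenCoefficient n (dyck< y) (dyck< (suc y)) (dyck<-odd y) ⟩
  (dyck< y ∗ dyck< (suc y)) (2 * n)
    ≡⟨ sym (dyck<-firstReturn y (suc (suc (2 * n)))) ⟩
  dyck< (suc y) (suc (suc (2 * n)))
    ≡⟨ cong (dyck< (suc y)) (sym (*-suc 2 n)) ⟩
  dyck< (suc y) y
    ≡⟨ dyck<-ballot (suc y) y ≤-refl ⟩
  catalan (suc n) ∎
  where
  y : ℕ
  y = 2 * suc n
  first : ∀ {k} → k < suc n → 2 * k < y
  first k<sn = *-monoʳ-< 2 k<sn
  second : ∀ k → 2 * (n ∸ k) < suc y
  second k = s≤s (*-monoʳ-≤ 2 (≤-trans (m∸n≤m n k) (n≤1+n n)))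

-- Counting step sequences and Dyck paths

∑-allWords-suc : ∀ m (f : List Step → ℕ) →
                 ∑[ w ∈ allWords (suc m) ] f w ≡ ∑[ w ∈ allWords m ] f (U ∷ w) + ∑[ w ∈ allWords m ] f (D ∷ w)
∑-allWords-suc m f = begin
  ∑[ w ∈ allWords (suc m) ] f w
    ≡⟨ ∑∈-concatMap (λ w → (U ∷ w) ∷ (D ∷ w) ∷ []) (allWords m) f ⟩
  ∑[ w ∈ allWords m ] (f (U ∷ w) + (f (D ∷ w) + 0))
    ≡⟨ ∑∈-cong (allWords m) (λ w → cong (f (U ∷ w) +_) (+-identityʳ (f (D ∷ w)))) ⟩
  ∑[ w ∈ allWords m ] (f (U ∷ w) + f (D ∷ w))
    ≡⟨ ∑∈-+ (allWords m) (λ w → f (U ∷ w)) (λ w → f (D ∷ w)) ⟩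
  ∑[ w ∈ allWords m ] f (U ∷ w) + ∑[ w ∈ allWords m ] f (D ∷ w) ∎

allWords-length : ∀ m → All (λ w → length w ≡ m) (allWords m)
allWords-length zero    = refl ∷ []
allWords-length (suc m) = concat⁺ (map⁺ (All.map (λ eq → cong suc eq ∷ cong suc eq ∷ []) (allWords-length m)))

heightFrom-≥ : ∀ ℓ w → ℓ ≤ heightFrom ℓ w
heightFrom-≥ ℓ []      = ≤-refl
heightFrom-≥ ℓ (U ∷ w) = m≤m⊔n ℓ _
heightFrom-≥ ℓ (D ∷ w) = m≤m⊔n ℓ _

heightFrom-≤ : ∀ ℓ w → heightFrom ℓ w ≤ ℓ + length w
heightFrom-≤ ℓ []      = m≤m+n ℓ 0
heightFrom-≤ ℓ (U ∷ w) = ⊔-lub (m≤m+n ℓ _)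
  (≤-trans (heightFrom-≤ (suc ℓ) w) (≤-reflexive (sym (+-suc ℓ (length w)))))
heightFrom-≤ ℓ (D ∷ w) = ⊔-lub (m≤m+n ℓ _)
  (≤-trans (heightFrom-≤ (ℓ ∸ 1) w) (+-mono-≤ (m∸n≤m ℓ 1) (n≤1+n (length w))))

heightFrom-U≤ : ∀ ℓ w c → heightFrom ℓ (U ∷ w) ≤ c → heightFrom (suc ℓ) w ≤ c
heightFrom-U≤ ℓ w c = ≤-trans (m≤n⊔m ℓ _)

≤-heightFrom-U : ∀ ℓ w c → heightFrom (suc ℓ) w ≤ c → heightFrom ℓ (U ∷ w) ≤ c
≤-heightFrom-U ℓ w c h≤c = ⊔-lub (≤-trans (n≤1+n ℓ) (≤-trans (heightFrom-≥ (suc ℓ) w) h≤c)) h≤c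

inStrip : ℕ → ℕ → List Step → ℕ
inStrip ℓ r w = 𝟙 (T? (validFrom ℓ w)) * 𝟙 (heightFrom ℓ w ≤? ℓ + r)

validFrom-U : ∀ ℓ w → validFrom ℓ (U ∷ w) ≡ validFrom (suc ℓ) w
validFrom-U zero    w = refl
validFrom-U (suc ℓ) w = refl

inStrip-U-ceiling : ∀ ℓ w → inStrip ℓ 0 (U ∷ w) ≡ 0
inStrip-U-ceiling ℓ w = trans
  (cong (𝟙 (T? (validFrom ℓ (U ∷ w))) *_) (𝟙-no (heightFrom ℓ (U ∷ w) ≤? ℓ + 0) too-high))
  (*-zeroʳ (𝟙 (T? (validFrom ℓ (U ∷ w)))))
  where
  too-high : ¬ heightFrom ℓ (U ∷ w) ≤ ℓ + 0
  too-high h≤ = 1+n≰n (≤-trans (heightFrom-≥ (suc ℓ) w)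
                               (≤-trans (heightFrom-U≤ ℓ w _ h≤) (≤-reflexive (+-identityʳ ℓ))))

inStrip-U : ∀ ℓ r w → inStrip ℓ (suc r) (U ∷ w) ≡ inStrip (suc ℓ) r w
inStrip-U ℓ r w = cong₂ _*_ (cong (𝟙 ∘ T?) (validFrom-U ℓ w))
  (𝟙-⇔ (heightFrom ℓ (U ∷ w) ≤? ℓ + suc r) (heightFrom (suc ℓ) w ≤? suc ℓ + r)
       (λ h≤ → subst (heightFrom (suc ℓ) w ≤_) (+-suc ℓ r) (heightFrom-U≤ ℓ w _ h≤))
       (λ h≤ → ≤-heightFrom-U ℓ w _ (subst (heightFrom (suc ℓ) w ≤_) (sym (+-suc ℓ r)) h≤)))

inStrip-D : ∀ ℓ r w → inStrip (suc ℓ) r (D ∷ w) ≡ inStrip ℓ (suc r) w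
inStrip-D ℓ r w = cong (𝟙 (T? (validFrom ℓ w)) *_)
  (𝟙-⇔ (heightFrom (suc ℓ) (D ∷ w) ≤? suc ℓ + r) (heightFrom ℓ w ≤? ℓ + suc r)
       (λ h≤ → subst (heightFrom ℓ w ≤_) (sym (+-suc ℓ r)) (≤-trans (m≤n⊔m (suc ℓ) _) h≤))
       (λ h≤ → ⊔-lub (m≤m+n (suc ℓ) r) (subst (heightFrom ℓ w ≤_) (+-suc ℓ r) h≤)))

∑-inStrip : ∀ m ℓ r → ∑[ w ∈ allWords m ] inStrip ℓ r w ≡ walks m ℓ r
∑-inStrip zero    zero    r = refl
∑-inStrip zero    (suc ℓ) r = refl
∑-inStrip (suc m) ℓ r = trans (∑-allWords-suc m (inStrip ℓ r)) (by-first-step ℓ r)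
  where
  by-first-step : ∀ ℓ r → ∑[ w ∈ allWords m ] inStrip ℓ r (U ∷ w) + ∑[ w ∈ allWords m ] inStrip ℓ r (D ∷ w) ≡
                          walks (suc m) ℓ r
  by-first-step zero zero = cong₂ _+_
    (trans (∑∈-cong (allWords m) (inStrip-U-ceiling 0)) (∑∈-zero (allWords m)))
    (∑∈-zero (allWords m))
  by-first-step zero (suc r) = trans
    (cong₂ _+_ (trans (∑∈-cong (allWords m) (inStrip-U 0 r)) (∑-inStrip m 1 r)) (∑∈-zero (allWords m)))
    (+-identityʳ _)
  by-first-step (suc ℓ) zero = cong₂ _+_
    (trans (∑∈-cong (allWords m) (inStrip-U-ceiling (suc ℓ))) (∑∈-zero (allWords m)))
    (trans (∑∈-cong (allWords m) (inStrip-D ℓ 0)) (∑-inStrip m ℓ 1))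
  by-first-step (suc ℓ) (suc r) = cong₂ _+_
    (trans (∑∈-cong (allWords m) (inStrip-U (suc ℓ) r)) (∑-inStrip m (suc (suc ℓ)) r))
    (trans (∑∈-cong (allWords m) (inStrip-D ℓ (suc r))) (∑-inStrip m ℓ (suc (suc r))))

dyckPaths-height : ∀ k → All (λ p → height p < suc (2 * k)) (dyckPaths k)
dyckPaths-height k = filter⁺ (λ w → T? (isDyck w))
  (All.map (λ {w} length≡ → s≤s (subst (height w ≤_) length≡ (heightFrom-≤ 0 w))) (allWords-length (2 * k)))

count-height≤ : ∀ k H → ∑[ p ∈ dyckPaths k ] 𝟙 (height p ≤? H) ≡ walks (2 * k) 0 H
count-height≤ k H = trans (∑∈-filter (λ w → T? (isDyck w)) (allWords (2 * k)) _) (∑-inStrip (2 * k) 0 H)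

count-height< : ∀ k y → ∑[ p ∈ dyckPaths k ] 𝟙 (height p <? y) ≡ dyck< y (2 * k)
count-height< k zero    = trans (∑∈-cong (dyckPaths k) (λ p → 𝟙-no (height p <? 0) λ ())) (∑∈-zero (dyckPaths k))
count-height< k (suc y) = trans
  (∑∈-cong (dyckPaths k) (λ p → 𝟙-⇔ (height p <? suc y) (height p ≤? y) s≤s⁻¹ s≤s))
  (count-height≤ k y)

count-heightExact : ∀ k y → ∑[ p ∈ dyckPaths k ] 𝟙 (height p ≟ y) ≡ dyckExact y (2 * k)
count-heightExact k y = sym (begin
  dyck< (suc y) (2 * k) ∸ dyck< y (2 * k)
    ≡⟨ cong₂ _∸_ (sym (count-height< k (suc y))) (sym (count-height< k y)) ⟩
  ∑[ p ∈ Pk ] 𝟙 (height p <? suc y) ∸ below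
    ≡⟨ cong (_∸ below) (trans (∑∈-cong Pk (λ p → 𝟙-<-suc (height p) y)) (∑∈-+ Pk _ _)) ⟩
  below + ∑[ p ∈ Pk ] 𝟙 (height p ≟ y) ∸ below
    ≡⟨ m+n∸m≡n below _ ⟩
  ∑[ p ∈ Pk ] 𝟙 (height p ≟ y) ∎)
  where
  Pk : List (List Step)
  Pk = dyckPaths k
  below : ℕ
  below = ∑[ p ∈ Pk ] 𝟙 (height p <? y)

length-dyckPaths : ∀ k → length (dyckPaths k) ≡ catalan k
length-dyckPaths k = begin
  length (dyckPaths k)
    ≡⟨ sym (trans (∑∈-const (dyckPaths k) 1) (*-identityʳ _)) ⟩
  ∑[ p ∈ dyckPaths k ] 1
    ≡⟨ ∑∈-congᴬ (All.map (λ {p} h< → sym (𝟙-yes (height p <? suc (2 * k)) h<)) (dyckPaths-height k)) ⟩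
  ∑[ p ∈ dyckPaths k ] 𝟙 (height p <? suc (2 * k))
    ≡⟨ count-height< k (suc (2 * k)) ⟩
  dyck< (suc (2 * k)) (2 * k)
    ≡⟨ dyck<-ballot (suc (2 * k)) (2 * k) ≤-refl ⟩
  catalan k ∎

-- Pairs of Dyck paths

pairSum : ℕ → (ℕ → ℕ → ℕ) → ℕ
pairSum n R = ∑[ k < suc n ] ∑[ p ∈ dyckPaths k ] ∑[ q ∈ dyckPaths (n ∸ k) ] R (height p) (height q)

countPairs-pairSum : ∀ n → countPairs n ≡ pairSum n (λ a b → 𝟙 (closeHeights? a b))
countPairs-pairSum n = begin
  countPairs n
    ≡⟨ length-filter close? (dyckPairs n) ⟩
  ∑[ pq ∈ dyckPairs n ] 𝟙 (close? pq)
    ≡⟨ ∑∈-concatMap splitAt (upTo (suc n)) (𝟙 ∘ close?) ⟩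
  ∑[ k ∈ upTo (suc n) ] ∑[ pq ∈ splitAt k ] 𝟙 (close? pq)
    ≡⟨ ∑∈-cong (upTo (suc n)) (λ k → ∑∈-pairs (dyckPaths k) (dyckPaths (n ∸ k)) (𝟙 ∘ close?)) ⟩
  ∑[ k ∈ upTo (suc n) ] ∑[ p ∈ dyckPaths k ] ∑[ q ∈ dyckPaths (n ∸ k) ] 𝟙 (closeHeights? (height p) (height q))
    ≡⟨ ∑∈-applyUpTo id _ (suc n) ⟩
  pairSum n (λ a b → 𝟙 (closeHeights? a b)) ∎
  where
  close? : (pq : List Step × List Step) → Dec (closeHeights (height (proj₁ pq)) (height (proj₂ pq)))
  close? (p , q) = closeHeights? (height p) (height q)

  splitAt : ℕ → List (List Step × List Step)
  splitAt k = concatMap (λ p → concatMap (λ q → (p , q) ∷ []) (dyckPaths (n ∸ k))) (dyckPaths k)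

pairSum-cong : ∀ n {R S : ℕ → ℕ → ℕ} → (∀ a b → R a b ≡ S a b) → pairSum n R ≡ pairSum n S
pairSum-cong n R≡S = ∑<-cong (suc n) (λ k _ →
  ∑∈-cong (dyckPaths k) (λ p → ∑∈-cong (dyckPaths (n ∸ k)) (λ q → R≡S _ _)))

pairSum-+ : ∀ n (R S : ℕ → ℕ → ℕ) → pairSum n (λ a b → R a b + S a b) ≡ pairSum n R + pairSum n S
pairSum-+ n R S = trans
  (∑<-cong (suc n) (λ k _ → trans
    (∑∈-cong (dyckPaths k) (λ p → ∑∈-+ (dyckPaths (n ∸ k)) _ _))
    (∑∈-+ (dyckPaths k) _ _)))
  (∑<-+ (suc n) _ _)

-- Reversing the order of the pair is the reindexing k ↦ n ∸ k.
pairSum-flip : ∀ n (R : ℕ → ℕ → ℕ) → pairSum n (λ a b → R b a) ≡ pairSum n R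
pairSum-flip n R = begin
  pairSum n (λ a b → R b a)
    ≡⟨ ∑<-cong (suc n) (λ k _ → ∑∈-swap (dyckPaths k) (dyckPaths (n ∸ k)) _) ⟩
  ∑[ k < suc n ] ∑[ q ∈ dyckPaths (n ∸ k) ] ∑[ p ∈ dyckPaths k ] R (height q) (height p)
    ≡⟨ ∑<-cong (suc n) (λ k k≤n → cong (λ j → ∑[ q ∈ dyckPaths (n ∸ k) ] ∑[ p ∈ dyckPaths j ] R (height q) (height p))
                                        (sym (m∸[m∸n]≡n (s≤s⁻¹ k≤n)))) ⟩
  ∑[ k < suc n ] ∑[ q ∈ dyckPaths (n ∸ k) ] ∑[ p ∈ dyckPaths (n ∸ (n ∸ k)) ] R (height q) (height p)
    ≡⟨ sym (∑<-reverse (suc n) _) ⟩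
  pairSum n R ∎

pairSum-one : ∀ n → pairSum n (λ _ _ → 1) ≡ catalan (suc n)
pairSum-one n = trans (∑<-cong (suc n) (λ k _ → count-pairs k)) (catalan-convolution n)
  where
  count-pairs : ∀ k → ∑[ p ∈ dyckPaths k ] ∑[ q ∈ dyckPaths (n ∸ k) ] 1 ≡ catalan k * catalan (n ∸ k)
  count-pairs k = begin
    ∑[ p ∈ dyckPaths k ] ∑[ q ∈ dyckPaths (n ∸ k) ] 1
      ≡⟨ ∑∈-cong (dyckPaths k) (λ _ → trans (∑∈-const (dyckPaths (n ∸ k)) 1) (*-identityʳ _)) ⟩
    ∑[ p ∈ dyckPaths k ] length (dyckPaths (n ∸ k))
      ≡⟨ ∑∈-const (dyckPaths k) _ ⟩
    length (dyckPaths k) * length (dyckPaths (n ∸ k))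
      ≡⟨ cong₂ _*_ (length-dyckPaths k) (length-dyckPaths (n ∸ k)) ⟩
    catalan k * catalan (n ∸ k) ∎

∑-height≤suc : ∀ i j K → 2 * j < K →
               ∑[ p ∈ dyckPaths i ] ∑[ q ∈ dyckPaths j ] 𝟙 (height p ≤? suc (height q)) ≡
               ∑[ y < K ] (dyck< (suc (suc y)) (2 * i) * dyckExact y (2 * j))
∑-height≤suc i j K 2j<K = begin
  ∑[ p ∈ dyckPaths i ] ∑[ q ∈ dyckPaths j ] 𝟙 (height p ≤? suc (height q))
    ≡⟨ ∑∈-swap (dyckPaths i) (dyckPaths j) _ ⟩
  ∑[ q ∈ dyckPaths j ] ∑[ p ∈ dyckPaths i ] 𝟙 (height p ≤? suc (height q))
    ≡⟨ ∑∈-cong (dyckPaths j) (λ q → count-height≤ i (suc (height q))) ⟩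
  ∑[ q ∈ dyckPaths j ] dyck< (suc (suc (height q))) (2 * i)
    ≡⟨ ∑∈-byValue height K (λ y → dyck< (suc (suc y)) (2 * i)) (dyckPaths j)
                  (All.map (λ h< → ≤-trans h< 2j<K) (dyckPaths-height j)) ⟩
  ∑[ y < K ] (dyck< (suc (suc y)) (2 * i) * (∑[ q ∈ dyckPaths j ] 𝟙 (height q ≟ y)))
    ≡⟨ ∑<-cong K (λ y _ → cong (dyck< (suc (suc y)) (2 * i) *_) (count-heightExact j y)) ⟩
  ∑[ y < K ] (dyck< (suc (suc y)) (2 * i) * dyckExact y (2 * j)) ∎

pairSum-height≤suc : ∀ n → pairSum (suc n) (λ a b → 𝟙 (a ≤? suc b)) ≡ catalan (suc n) + catalan (suc n)
pairSum-height≤suc n = begin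
  pairSum N (λ a b → 𝟙 (a ≤? suc b))
    ≡⟨ ∑<-cong (suc N) (λ k _ → ∑-height≤suc k (N ∸ k) K (s≤s (*-monoʳ-≤ 2 (m∸n≤m N k)))) ⟩
  ∑[ k < suc N ] ∑[ y < K ] (dyck< (suc (suc y)) (2 * k) * dyckExact y (2 * (N ∸ k)))
    ≡⟨ ∑<-swap (suc N) K _ ⟩
  ∑[ y < K ] ∑[ k < suc N ] (dyck< (suc (suc y)) (2 * k) * dyckExact y (2 * (N ∸ k)))
    ≡⟨ ∑<-cong K (λ y _ → trans (∗-evenCoefficient N (dyck< (suc (suc y))) (dyckExact y) (dyck<-odd (suc (suc y))))
                                 (∗-comm (dyck< (suc (suc y))) (dyckExact y) (2 * N))) ⟩
  ∑[ y < K ] (dyckExact y ∗ dyck< (suc (suc y))) (2 * N)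
    ≡⟨ sym (+-identityʳ _) ⟩
  ∑[ y < K ] (dyckExact y ∗ dyck< (suc (suc y))) (2 * N) + dyckExact 0 (2 * N)
    ≡⟨ ∑-dyckExact-∗ K (2 * N) ⟩
  dyck< K (2 * N) + dyck< (suc K) (2 * N)
    ≡⟨ cong₂ _+_ (dyck<-ballot K (2 * N) ≤-refl) (dyck<-ballot (suc K) (2 * N) (n≤1+n K)) ⟩
  catalan N + catalan N ∎
  where
  N K : ℕ
  N = suc n
  K = suc (2 * N)

𝟙-closeHeights+1 : ∀ a b → 𝟙 (closeHeights? a b) + 1 ≡ 𝟙 (a ≤? suc b) + 𝟙 (b ≤? suc a)
𝟙-closeHeights+1 a b = 𝟙-×-dec+1 (a ≤? suc b) (b ≤? suc a) (Sum.map m≤n⇒m≤1+n m≤n⇒m≤1+n (≤-total a b))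

countPairs-catalan : ∀ n → let c = catalan (suc n) in countPairs (suc n) + catalan (suc (suc n)) ≡ (c + c) + (c + c)
countPairs-catalan n = begin
  countPairs N + catalan (suc N)
    ≡⟨ cong₂ _+_ (countPairs-pairSum N) (sym (pairSum-one N)) ⟩
  pairSum N (λ a b → 𝟙 (closeHeights? a b)) + pairSum N (λ _ _ → 1)
    ≡⟨ sym (pairSum-+ N (λ a b → 𝟙 (closeHeights? a b)) (λ _ _ → 1)) ⟩
  pairSum N (λ a b → 𝟙 (closeHeights? a b) + 1)
    ≡⟨ pairSum-cong N 𝟙-closeHeights+1 ⟩
  pairSum N (λ a b → 𝟙 (a ≤? suc b) + 𝟙 (b ≤? suc a))
    ≡⟨ pairSum-+ N (λ a b → 𝟙 (a ≤? suc b)) (λ a b → 𝟙 (b ≤? suc a)) ⟩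
  pairSum N (λ a b → 𝟙 (a ≤? suc b)) + pairSum N (λ a b → 𝟙 (b ≤? suc a))
    ≡⟨ cong (pairSum N (λ a b → 𝟙 (a ≤? suc b)) +_) (pairSum-flip N (λ a b → 𝟙 (a ≤? suc b))) ⟩
  pairSum N (λ a b → 𝟙 (a ≤? suc b)) + pairSum N (λ a b → 𝟙 (a ≤? suc b))
    ≡⟨ cong₂ _+_ (pairSum-height≤suc n) (pairSum-height≤suc n) ⟩
  (catalan N + catalan N) + (catalan N + catalan N) ∎
  where
  N : ℕ
  N = suc n

-- C_n n! (n+2)! = (n+2) (2n)!  and  C_{n+1} n! (n+2)! = 2 (2n+1) (2n)!,
-- and 4 (n+2) - 2 (2n+1) = 6.
T2-fromCatalan : ∀ n x → x + catalan (suc n) ≡ (catalan n + catalan n) + (catalan n + catalan n) → T2 n ≡ x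
T2-fromCatalan n x x+c′≡4c = begin
  T2 n              ≡⟨ cong (_/ den) (sym x*den) ⟩
  (x * den) / den   ≡⟨ m*n/n≡m x den ⟩
  x                 ∎
  where
  c c′ den F : ℕ
  c   = catalan n
  c′  = catalan (suc n)
  den = n ! * (n + 2) !
  F   = (2 * n) !

  instance
    den≢0 : NonZero den
    den≢0 = n !* (n + 2) !≢0

  den≡ : den ≡ n ! * (suc (suc n) * suc n !)
  den≡ = cong (λ m → n ! * m !) (+-comm n 2)

  c*den : c * den ≡ suc (suc n) * F
  c*den = begin
    c * den                               ≡⟨ cong (c *_) den≡ ⟩
    c * (n ! * (suc (suc n) * suc n !))   ≡⟨ commute c (n !) (suc n !) n ⟩
    suc (suc n) * (c * (n ! * suc n !))   ≡⟨ cong (suc (suc n) *_) (catalan-formula n) ⟩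
    suc (suc n) * F                       ∎
    where
    commute : ∀ c a b n → c * (a * (suc (suc n) * b)) ≡ suc (suc n) * (c * (a * b))
    commute = solve-∀

  c′*den : c′ * den ≡ 2 * (suc (2 * n) * F)
  c′*den = *-cancelˡ-≡ _ _ (suc n) (begin
    suc n * (c′ * den)                               ≡⟨ cong (λ d → suc n * (c′ * d)) den≡ ⟩
    suc n * (c′ * (n ! * (suc (suc n) * suc n !)))   ≡⟨ regroup c′ (n !) (suc n !) n ⟩
    c′ * ((suc n * n !) * suc (suc n) !)             ≡⟨ catalan-formula (suc n) ⟩
    (2 * suc n) !                                    ≡⟨ cong _! (*-suc 2 n) ⟩
    suc (suc (2 * n)) * (suc (2 * n) * F)            ≡⟨ halve n (suc (2 * n) * F) ⟩
    suc n * (2 * (suc (2 * n) * F))                  ∎)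
    where
    regroup : ∀ c a b n → suc n * (c * (a * (suc (suc n) * b))) ≡ c * ((suc n * a) * (suc (suc n) * b))
    regroup = solve-∀
    halve : ∀ n z → suc (suc (2 * n)) * z ≡ suc n * (2 * z)
    halve = solve-∀

  x*den : x * den ≡ 6 * F
  x*den = +-cancelʳ-≡ (c′ * den) (x * den) (6 * F) (begin
    x * den + c′ * den              ≡⟨ sym (*-distribʳ-+ den x c′) ⟩
    (x + c′) * den                  ≡⟨ cong (_* den) x+c′≡4c ⟩
    ((c + c) + (c + c)) * den       ≡⟨ quadruple c den ⟩
    4 * (c * den)                   ≡⟨ cong (4 *_) c*den ⟩
    4 * (suc (suc n) * F)           ≡⟨ split n F ⟩
    6 * F + 2 * (suc (2 * n) * F)   ≡⟨ cong (6 * F +_) (sym c′*den) ⟩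
    6 * F + c′ * den                ∎)
    where
    quadruple : ∀ c d → ((c + c) + (c + c)) * d ≡ 4 * (c * d)
    quadruple = solve-∀
    split : ∀ n F → 4 * (suc (suc n) * F) ≡ 6 * F + 2 * (suc (2 * n) * F)
    split = solve-∀

theorem2p2 : (n : ℕ) → n ≥ 1 → T2 n ≡ countPairs n
theorem2p2 (suc n) _ = T2-fromCatalan (suc n) (countPairs (suc n)) (countPairs-catalan n)
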